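{- For real $r$ define $U_r = \frac12 r(r+1)$, so that $U_r = \sum_{q=1}^{r} q$ when $r \in \mathbb{N}$. For positive integers $n$ and $k$ define the average $$\bar U_{n/k} = \frac{1}{k}\sum_{j=0}^{k-1} U_{\frac{n-j}{k}}.$$ Then for all positive integers $n, k$ with $2 \le k < n$ one has the exact identity $$\frac{U_n - k^2\,\bar U_{n/k}}{1-k^2} = -\frac{1}{12},$$ that is, $U_n - k^2\bar U_{n/k} = -\frac{1}{12}(1-k^2)$. -}

module Defs where

open import Data.Nat as ℕ using (ℕ; zero; suc; NonZero)
open import Data.Integer as ℤ using (ℤ; +_)
open import Data.Rational using (ℚ; _/_; _+_; _*_; _-_; ½; 0ℚ; 1ℚ)

U : ℚ → ℚ
U r = ½ * r * (r + 1ℚ)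

sumBelow : ℕ → (ℕ → ℚ) → ℚ
sumBelow zero    f = 0ℚ
sumBelow (suc k) f = sumBelow k f + f k

ℕtoℚ : ℕ → ℚ
ℕtoℚ m = + m / 1

Ubar : (n k : ℕ) → .{{_ : NonZero k}} → ℚ
Ubar n k = (+ 1 / k) * sumBelow k (λ j → U ((+ n ℤ.- + j) / k))

-- With c = 1/k, the average Ū_{n/k} is c times a sum of the quadratic U over the
-- arithmetic progression (n - j) c, j < k, which telescopes to a polynomial in n, k, c.
-- Multiplying by k² and using k c = 1 leaves ½ (k⁻¹ Σ (n - j)² + Σ (n - j)) over j < k;
-- all terms involving n then cancel against U_n, and what remains is -(1 - k²)/12.
module Submission where

open import Defs
open import Data.Nat using (ℕ; NonZero; zero; suc; _≤_; _<_)
import Data.Nat.Properties as ℕ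
open import Data.Integer as ℤ using (ℤ; +_)
import Data.Integer.Tactic.RingSolver as ℤ-Solver
open import Data.Rational using (ℚ; _/_; _+_; _*_; _-_; -_; ½; 0ℚ; 1ℚ; fromℚᵘ; toℚᵘ)
open import Data.Rational.Properties
  using (+-*-commutativeRing; _≟_; +-comm; toℚᵘ-injective; toℚᵘ-fromℚᵘ; fromℚᵘ-cong;
         toℚᵘ-homo-+; toℚᵘ-homo-*; toℚᵘ-homo‿-)
import Data.Rational.Unnormalised.Base as ℚᵘ
open ℚᵘ using (ℚᵘ; mkℚᵘ; *≡*) renaming (_≃_ to _≃ᵘ_)
import Data.Rational.Unnormalised.Properties as ℚᵘ
open import Function.Base using (_∘_)
open import Level using (0ℓ)
open import Relation.Binary.PropositionalEquality
  using (_≡_; refl; sym; trans; cong; cong₂; module ≡-Reasoning)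
open import Relation.Nullary.Decidable using (dec⇒maybe)
open import Tactic.RingSolver using (solve-∀)
import Tactic.RingSolver.Core.AlmostCommutativeRing as ACR

-- meanSquare N M and mean N M are the averages of (N - x)² and N - x over x = 0, …, M - 1,
-- so that sumU N c M = Σ_{x<M} U((N - x) c).  They are inlined because the reflective
-- ring solver only looks through ring operations; for the same reason U is written out
-- in the statements handed to it.
meanSquare : ℚ → ℚ → ℚ
meanSquare N M = N * N - N * (M - 1ℚ) + (M - 1ℚ) * (M + M - 1ℚ) * (+ 1 / 6)
{-# INLINE meanSquare #-}

mean : ℚ → ℚ → ℚ
mean N M = N - (M - 1ℚ) * ½
{-# INLINE mean #-}

sumU : ℚ → ℚ → ℚ → ℚ
sumU N c M = ½ * M * (c * c * meanSquare N M + c * mean N M)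
{-# INLINE sumU #-}

ℚ-ring : ACR.AlmostCommutativeRing 0ℓ 0ℓ
ℚ-ring = ACR.fromCommutativeRing +-*-commutativeRing (λ x → dec⇒maybe (0ℚ ≟ x))

-- i / suc d is by definition fromℚᵘ (mkℚᵘ i d), and ℕtoℚ m is ℤtoℚ (+ m), so the casts
-- below reduce to identities between unnormalised fractions.
ℤtoℚ : ℤ → ℚ
ℤtoℚ i = i / 1

fromℚᵘ-homo₂ : {_∙_ : ℚ → ℚ → ℚ} {_∘ᵘ_ : ℚᵘ → ℚᵘ → ℚᵘ} →
               (∀ p q → toℚᵘ (p ∙ q) ≃ᵘ toℚᵘ p ∘ᵘ toℚᵘ q) →
               (∀ {p p′ q q′} → p ≃ᵘ p′ → q ≃ᵘ q′ → p ∘ᵘ q ≃ᵘ p′ ∘ᵘ q′) →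
               ∀ p q → fromℚᵘ (p ∘ᵘ q) ≡ fromℚᵘ p ∙ fromℚᵘ q
fromℚᵘ-homo₂ {_∙_} {_∘ᵘ_} homo ∘ᵘ-cong p q = toℚᵘ-injective (begin
  toℚᵘ (fromℚᵘ (p ∘ᵘ q))             ≈⟨ toℚᵘ-fromℚᵘ (p ∘ᵘ q) ⟩
  p ∘ᵘ q                              ≈⟨ ∘ᵘ-cong (ℚᵘ.≃-sym (toℚᵘ-fromℚᵘ p)) (ℚᵘ.≃-sym (toℚᵘ-fromℚᵘ q)) ⟩
  toℚᵘ (fromℚᵘ p) ∘ᵘ toℚᵘ (fromℚᵘ q)  ≈⟨ ℚᵘ.≃-sym (homo (fromℚᵘ p) (fromℚᵘ q)) ⟩
  toℚᵘ (fromℚᵘ p ∙ fromℚᵘ q)          ∎)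
  where open ℚᵘ.≃-Reasoning

fromℚᵘ-homo-+ : ∀ p q → fromℚᵘ (p ℚᵘ.+ q) ≡ fromℚᵘ p + fromℚᵘ q
fromℚᵘ-homo-+ = fromℚᵘ-homo₂ toℚᵘ-homo-+ ℚᵘ.+-cong

fromℚᵘ-homo-* : ∀ p q → fromℚᵘ (p ℚᵘ.* q) ≡ fromℚᵘ p * fromℚᵘ q
fromℚᵘ-homo-* = fromℚᵘ-homo₂ toℚᵘ-homo-* ℚᵘ.*-cong

fromℚᵘ-homo‿- : ∀ p → fromℚᵘ (ℚᵘ.- p) ≡ - fromℚᵘ p
fromℚᵘ-homo‿- p = toℚᵘ-injective (begin
  toℚᵘ (fromℚᵘ (ℚᵘ.- p))  ≈⟨ toℚᵘ-fromℚᵘ (ℚᵘ.- p) ⟩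
  ℚᵘ.- p                   ≈⟨ ℚᵘ.-‿cong (ℚᵘ.≃-sym (toℚᵘ-fromℚᵘ p)) ⟩
  ℚᵘ.- toℚᵘ (fromℚᵘ p)     ≈⟨ ℚᵘ.≃-sym (toℚᵘ-homo‿- (fromℚᵘ p)) ⟩
  toℚᵘ (- fromℚᵘ p)        ∎)
  where open ℚᵘ.≃-Reasoning

open ≡-Reasoning

ℤtoℚ-homo-+ : ∀ a b → ℤtoℚ (a ℤ.+ b) ≡ ℤtoℚ a + ℤtoℚ b
ℤtoℚ-homo-+ a b = trans (fromℚᵘ-cong a+b≃a+b) (fromℚᵘ-homo-+ (mkℚᵘ a 0) (mkℚᵘ b 0))
  where
  cross : ∀ a b → (a ℤ.+ b) ℤ.* + 1 ≡ (a ℤ.* + 1 ℤ.+ b ℤ.* + 1) ℤ.* + 1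
  cross = ℤ-Solver.solve-∀
  a+b≃a+b : mkℚᵘ (a ℤ.+ b) 0 ≃ᵘ mkℚᵘ a 0 ℚᵘ.+ mkℚᵘ b 0
  a+b≃a+b = *≡* (cross a b)

ℤtoℚ-homo‿- : ∀ a → ℤtoℚ (ℤ.- a) ≡ - ℤtoℚ a
ℤtoℚ-homo‿- a = fromℚᵘ-homo‿- (mkℚᵘ a 0)

i/n≡i*[1/n] : ∀ i n .{{_ : NonZero n}} → i / n ≡ ℤtoℚ i * (+ 1 / n)
i/n≡i*[1/n] i (suc n) =
  trans (fromℚᵘ-cong i/n≃i*[1/n]) (fromℚᵘ-homo-* (mkℚᵘ i 0) (mkℚᵘ (+ 1) n))
  where
  cross : ∀ i d → i ℤ.* d ≡ (i ℤ.* + 1) ℤ.* d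
  cross = ℤ-Solver.solve-∀
  i/n≃i*[1/n] : mkℚᵘ i n ≃ᵘ mkℚᵘ i 0 ℚᵘ.* mkℚᵘ (+ 1) n
  i/n≃i*[1/n] rewrite ℕ.+-identityʳ n = *≡* (cross i (+ suc n))

n*[1/n]≡1 : ∀ n .{{_ : NonZero n}} → ℕtoℚ n * (+ 1 / n) ≡ 1ℚ
n*[1/n]≡1 (suc n) =
  trans (sym (fromℚᵘ-homo-* (mkℚᵘ (+ suc n) 0) (mkℚᵘ (+ 1) n))) (fromℚᵘ-cong n*[1/n]≃1)
  where
  cross : ∀ d → (d ℤ.* + 1) ℤ.* + 1 ≡ + 1 ℤ.* d
  cross = ℤ-Solver.solve-∀
  n*[1/n]≃1 : mkℚᵘ (+ suc n) 0 ℚᵘ.* mkℚᵘ (+ 1) n ≃ᵘ ℚᵘ.1ℚᵘ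
  n*[1/n]≃1 rewrite ℕ.+-identityʳ n = *≡* (cross (+ suc n))

ℕtoℚ-suc : ∀ m → ℕtoℚ (suc m) ≡ ℕtoℚ m + 1ℚ
ℕtoℚ-suc m = trans (ℤtoℚ-homo-+ (+ 1) (+ m)) (+-comm 1ℚ (ℕtoℚ m))

[m-n]/d≡[m-n]*[1/d] : ∀ m n d .{{_ : NonZero d}} →
                      (+ m ℤ.- + n) / d ≡ (ℕtoℚ m - ℕtoℚ n) * (+ 1 / d)
[m-n]/d≡[m-n]*[1/d] m n d = begin
  (+ m ℤ.- + n) / d                           ≡⟨ i/n≡i*[1/n] (+ m ℤ.- + n) d ⟩
  ℤtoℚ (+ m ℤ.- + n) * (+ 1 / d)              ≡⟨ cong (_* (+ 1 / d)) (ℤtoℚ-homo-+ (+ m) (ℤ.- + n)) ⟩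
  (ℕtoℚ m + ℤtoℚ (ℤ.- + n)) * (+ 1 / d)       ≡⟨ cong (λ x → (ℕtoℚ m + x) * (+ 1 / d)) (ℤtoℚ-homo‿- (+ n)) ⟩
  (ℕtoℚ m - ℕtoℚ n) * (+ 1 / d)               ∎

sumBelow-cong : ∀ m {f g : ℕ → ℚ} → (∀ j → f j ≡ g j) → sumBelow m f ≡ sumBelow m g
sumBelow-cong zero    f≡g = refl
sumBelow-cong (suc m) f≡g = cong₂ _+_ (sumBelow-cong m f≡g) (f≡g m)

sumBelow-telescope : (F f : ℚ → ℚ) → F 0ℚ ≡ 0ℚ → (∀ x → F (x + 1ℚ) ≡ F x + f x) →
                     ∀ m → sumBelow m (f ∘ ℕtoℚ) ≡ F (ℕtoℚ m)
sumBelow-telescope F f F0≡0 step zero    = sym F0≡0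
sumBelow-telescope F f F0≡0 step (suc m) = begin
  sumBelow m (f ∘ ℕtoℚ) + f (ℕtoℚ m)  ≡⟨ cong (_+ f (ℕtoℚ m)) (sumBelow-telescope F f F0≡0 step m) ⟩
  F (ℕtoℚ m) + f (ℕtoℚ m)             ≡⟨ sym (step (ℕtoℚ m)) ⟩
  F (ℕtoℚ m + 1ℚ)                     ≡⟨ cong F (sym (ℕtoℚ-suc m)) ⟩
  F (ℕtoℚ (suc m))                    ∎

sumBelow-U-affine : ∀ N c m → sumBelow m (λ j → U ((N - ℕtoℚ j) * c)) ≡ sumU N c (ℕtoℚ m)
sumBelow-U-affine N c =
  sumBelow-telescope (sumU N c) (λ x → U ((N - x) * c)) (sumU-zero N c) (sumU-suc N c)
  where
  sumU-zero : ∀ N c → sumU N c 0ℚ ≡ 0ℚ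
  sumU-zero = solve-∀ ℚ-ring
  sumU-suc : ∀ N c M → sumU N c (M + 1ℚ) ≡ sumU N c M + ½ * ((N - M) * c) * ((N - M) * c + 1ℚ)
  sumU-suc = solve-∀ ℚ-ring

sumU-rescaled : ∀ N K c → K * c ≡ 1ℚ →
                K * K * (c * sumU N c K) ≡ ½ * (meanSquare N K + K * mean N K)
sumU-rescaled N K c Kc≡1 = begin
  K * K * (c * sumU N c K)  ≡⟨ in-powers-of-Kc N K c ⟩
  P (K * c)                 ≡⟨ cong P Kc≡1 ⟩
  P 1ℚ                      ≡⟨ P-at-1 N K ⟩
  ½ * (meanSquare N K + K * mean N K)  ∎
  where
  P : ℚ → ℚ
  P t = ½ * (t * t * t * meanSquare N K + t * t * K * mean N K)
  in-powers-of-Kc : ∀ N K c → K * K * (c * sumU N c K) ≡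
    ½ * ((K * c) * (K * c) * (K * c) * meanSquare N K + (K * c) * (K * c) * K * mean N K)
  in-powers-of-Kc = solve-∀ ℚ-ring
  P-at-1 : ∀ N K → ½ * (1ℚ * 1ℚ * 1ℚ * meanSquare N K + 1ℚ * 1ℚ * K * mean N K) ≡
                   ½ * (meanSquare N K + K * mean N K)
  P-at-1 = solve-∀ ℚ-ring

U-sub-rescaled-sum : ∀ N K →
  ½ * N * (N + 1ℚ) - ½ * (meanSquare N K + K * mean N K) ≡ - (+ 1 / 12) * (1ℚ - K * K)
U-sub-rescaled-sum = solve-∀ ℚ-ring

k²*Ubar : ∀ n k .{{_ : NonZero k}} →
          ℕtoℚ k * ℕtoℚ k * Ubar n k ≡
          ½ * (meanSquare (ℕtoℚ n) (ℕtoℚ k) + ℕtoℚ k * mean (ℕtoℚ n) (ℕtoℚ k))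
k²*Ubar n k = begin
  K * K * (c * sumBelow k (λ j → U ((+ n ℤ.- + j) / k)))  ≡⟨ cong (λ s → K * K * (c * s)) sum≡sumU ⟩
  K * K * (c * sumU N c K)                                 ≡⟨ sumU-rescaled N K c (n*[1/n]≡1 k) ⟩
  ½ * (meanSquare N K + K * mean N K)                      ∎
  where
  N = ℕtoℚ n
  K = ℕtoℚ k
  c = + 1 / k
  sum≡sumU : sumBelow k (λ j → U ((+ n ℤ.- + j) / k)) ≡ sumU N c K
  sum≡sumU = trans (sumBelow-cong k (λ j → cong U ([m-n]/d≡[m-n]*[1/d] n j k)))
                   (sumBelow-U-affine N c k)

theorem2 : (n k : ℕ) .{{_ : NonZero k}} → 2 ≤ k → k < n →
    U (ℕtoℚ n) - ℕtoℚ k * ℕtoℚ k * Ubar n k ≡ - (+ 1 / 12) * (1ℚ - ℕtoℚ k * ℕtoℚ k)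
theorem2 n k _ _ = begin
  U N - K * K * Ubar n k                     ≡⟨ cong (λ x → U N - x) (k²*Ubar n k) ⟩
  U N - ½ * (meanSquare N K + K * mean N K)  ≡⟨ U-sub-rescaled-sum N K ⟩
  - (+ 1 / 12) * (1ℚ - K * K)                ∎
  where
  N = ℕtoℚ n
  K = ℕtoℚ k
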